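{- Let $\Phi$ be a context, $e$ an evidence term and $F$ a formula such that $\Phi \vdash e : F$ is derivable in the type system below. Then $e$ is terminating with respect to weak head reduction, i.e. there is no infinite weak head reduction sequence starting from $e$.
   Context: Terms $t ::= x \mid K \mid t\,t'$; atomic formulas $A ::= P\,t_1\cdots t_n$. Formulas: $F ::= A \mid \forall x.F \mid F \Rightarrow F'$. Evidence: $e ::= \kappa \mid \alpha \mid \lambda\alpha.e \mid e\,e' \mid \mu\alpha.e$ ($\kappa$ constants, $\alpha$ variables). Contexts: $\Phi ::= \cdot \mid e : F, \Phi$. Let $a$ range over constants $\kappa$ and variables $\alpha$. A term $e$ is in head normal form, $\mathrm{HNF}(e)$, if $e = \lambda\alpha_1\cdots\lambda\alpha_k.\,\kappa\,e_1\cdots e_l$ ($k,l\ge 0$). Typing rules: (Assump) if $(a : F) \in \Phi$ then $\Phi \vdash a : F$; (App) if $\Phi \vdash e_1 : F'$ and $\Phi \vdash e_2 : F' \Rightarrow F$ then $\Phi \vdash e_2\,e_1 : F$; (Abs) if $\Phi, \alpha : F' \vdash e : F$ then $\Phi \vdash \lambda\alpha.e : F' \Rightarrow F$; (Gen) if $\Phi \vdash e : F$ and $x \notin \mathrm{FV}(\Phi)$ then $\Phi \vdash e : \forall x.F$; (Inst) if $\Phi \vdash e : \forall x.F$ then $\Phi \vdash e : [t/x]F$; (Mu) if $\Phi, \alpha : F \vdash e : F$ and $\mathrm{HNF}(e)$ then $\Phi \vdash \mu\alpha.e : F$. Weak head reduction contexts: $\mathcal{C} ::= \bullet \mid \mathcal{C}\,e$.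 Weak head reduction: $\mathcal{C}[\mu\alpha.e] \leadsto \mathcal{C}[[\mu\alpha.e/\alpha]e]$ and $\mathcal{C}[(\lambda\alpha.e)\,e'] \leadsto \mathcal{C}[[e'/\alpha]e]$. -}

module Defs where

open import Data.Nat using (ℕ; zero; suc; _≟_)
open import Data.List using (List; []; _∷_; map)
open import Data.List.Relation.Unary.Any using (Any)
open import Data.List.Membership.Propositional using (_∈_)
open import Data.Product using (Σ; _×_; _,_; proj₁; proj₂)
open import Relation.Nullary using (¬_; yes; no)
open import Relation.Binary.PropositionalEquality using (_≡_)

-- Free first-order variables x are named by ℕ (fv x); variables bound
-- by ∀ are de Bruijn indices (bv k).

data Term : Set where
  fv   : ℕ → Term
  bv   : ℕ → Term            -- bound variable (only inside formulas)
  con  : ℕ → Term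
  _·_  : Term → Term → Term

-- a genuine term of the grammar t ::= x | K | t t' (no bound indices)
data LC : Term → Set where
  lc-fv  : ∀ x → LC (fv x)
  lc-con : ∀ K → LC (con K)
  lc-app : ∀ {t t'} → LC t → LC t' → LC (t · t')

infixr 5 _⇒_
data Formula : Set where
  atom : ℕ → List Term → Formula
  ∀'   : Formula → Formula         -- ∀x.F  (body uses bv 0 for x)
  _⇒_  : Formula → Formula → Formula

openT : ℕ → Term → Term → Term
openT k u (fv x) = fv x
openT k u (bv j) with k ≟ j
... | yes _ = u
... | no _  = bv j
openT k u (con K) = con K
openT k u (t · t') = openT k u t · openT k u t'

openTs : ℕ → Term → List Term → List Term
openTs k u [] = []
openTs k u (t ∷ ts) = openT k u t ∷ openTs k u ts

openF : ℕ → Term → Formula → Formula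
openF k u (atom P ts) = atom P (openTs k u ts)
openF k u (∀' F) = ∀' (openF (suc k) u F)
openF k u (F ⇒ G) = openF k u F ⇒ openF k u G

-- [t/x]F  for  ∀x.F  represented as  ∀' F
instantiate : Term → Formula → Formula
instantiate t F = openF 0 t F

closeT : ℕ → ℕ → Term → Term
closeT k x (fv y) with x ≟ y
... | yes _ = bv k
... | no _  = fv y
closeT k x (bv j) = bv j
closeT k x (con K) = con K
closeT k x (t · t') = closeT k x t · closeT k x t'

closeTs : ℕ → ℕ → List Term → List Term
closeTs k x [] = []
closeTs k x (t ∷ ts) = closeT k x t ∷ closeTs k x ts

closeF : ℕ → ℕ → Formula → Formula
closeF k x (atom P ts) = atom P (closeTs k x ts)
closeF k x (∀' F) = ∀' (closeF (suc k) x F)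
closeF k x (F ⇒ G) = closeF k x F ⇒ closeF k x G

-- ∀x.F  where F mentions x as a free variable
forallNamed : ℕ → Formula → Formula
forallNamed x F = ∀' (closeF 0 x F)

data OccT (x : ℕ) : Term → Set where
  here  : OccT x (fv x)
  appˡ  : ∀ {t t'} → OccT x t  → OccT x (t · t')
  appʳ  : ∀ {t t'} → OccT x t' → OccT x (t · t')

data OccF (x : ℕ) : Formula → Set where
  atom : ∀ {P ts} → Any (OccT x) ts → OccF x (atom P ts)
  all  : ∀ {F} → OccF x F → OccF x (∀' F)
  impˡ : ∀ {F G} → OccF x F → OccF x (F ⇒ G)
  impʳ : ∀ {F G} → OccF x G → OccF x (F ⇒ G)

-- Evidence terms (de Bruijn indices for evidence variables α)

data Ev : Set where
  κ   : ℕ → Ev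
  var : ℕ → Ev
  ƛ   : Ev → Ev
  _∙_ : Ev → Ev → Ev
  μ   : Ev → Ev

ext : (ℕ → ℕ) → ℕ → ℕ
ext ρ zero = zero
ext ρ (suc n) = suc (ρ n)

rename : (ℕ → ℕ) → Ev → Ev
rename ρ (κ c) = κ c
rename ρ (var n) = var (ρ n)
rename ρ (ƛ e) = ƛ (rename (ext ρ) e)
rename ρ (e ∙ e') = rename ρ e ∙ rename ρ e'
rename ρ (μ e) = μ (rename (ext ρ) e)

exts : (ℕ → Ev) → ℕ → Ev
exts σ zero = var zero
exts σ (suc n) = rename suc (σ n)

subst : (ℕ → Ev) → Ev → Ev
subst σ (κ c) = κ c
subst σ (var n) = σ n
subst σ (ƛ e) = ƛ (subst (exts σ) e)
subst σ (e ∙ e') = subst σ e ∙ subst σ e'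
subst σ (μ e) = μ (subst (exts σ) e)

-- [e'/α]e where α is index 0 of e
sub0 : Ev → ℕ → Ev
sub0 e' zero = e'
sub0 e' (suc n) = var n

_[_] : Ev → Ev → Ev
e [ e' ] = subst (sub0 e') e

data IsAtom : Ev → Set where
  atom-κ   : ∀ c → IsAtom (κ c)
  atom-var : ∀ n → IsAtom (var n)

data Spine : Ev → Set where
  sp-κ   : ∀ c → Spine (κ c)
  sp-app : ∀ {e e'} → Spine e → Spine (e ∙ e')

data HNF : Ev → Set where
  hnf-spine : ∀ {e} → Spine e → HNF e
  hnf-lam   : ∀ {e} → HNF e → HNF (ƛ e)

Ctx : Set
Ctx = List (Ev × Formula)

-- weakening the evidence in a context when binding a new evidence var
shiftCtx : Ctx → Ctx
shiftCtx = map (λ p → rename suc (proj₁ p) , proj₂ p)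

_,α∶_ : Ctx → Formula → Ctx
Φ ,α∶ F = (var zero , F) ∷ shiftCtx Φ

_∈FV_ : ℕ → Ctx → Set
x ∈FV Φ = Any (λ p → OccF x (proj₂ p)) Φ

infix 3 _⊢_∶_
data _⊢_∶_ (Φ : Ctx) : Ev → Formula → Set where
  Assump : ∀ {a F} → IsAtom a → (a , F) ∈ Φ → Φ ⊢ a ∶ F
  App    : ∀ {e₁ e₂ F F'} → Φ ⊢ e₁ ∶ F' → Φ ⊢ e₂ ∶ F' ⇒ F → Φ ⊢ e₂ ∙ e₁ ∶ F
  Abs    : ∀ {e F F'} → (Φ ,α∶ F') ⊢ e ∶ F → Φ ⊢ ƛ e ∶ F' ⇒ F
  Gen    : ∀ {e F x} → Φ ⊢ e ∶ F → ¬ (x ∈FV Φ) → Φ ⊢ e ∶ forallNamed x F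
  Inst   : ∀ {e F t} → LC t → Φ ⊢ e ∶ ∀' F → Φ ⊢ e ∶ instantiate t F
  Mu     : ∀ {e F} → (Φ ,α∶ F) ⊢ e ∶ F → HNF e → Φ ⊢ μ e ∶ F

infix 4 _↝_
data _↝_ : Ev → Ev → Set where
  β-μ   : ∀ {e} → μ e ↝ e [ μ e ]
  β-λ   : ∀ {e e'} → ƛ e ∙ e' ↝ e [ e' ]
  ctx   : ∀ {e₁ e₂ e'} → e₁ ↝ e₂ → e₁ ∙ e' ↝ e₂ ∙ e'

Terminating : Ev → Set
Terminating e = ¬ (Σ (ℕ → Ev) λ f → (f 0 ≡ e) × (∀ n → f n ↝ f (suc n)))

-- Tait's reducibility method, after erasing formulas to simple types: the
-- evidence term does not change under Gen and Inst, so quantifiers are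
-- invisible to reduction.  At the base type reducibility is strong
-- normalisation, which is closed under weak head expansion because weak head
-- reduction is deterministic.  Fixpoints need no induction at all: the Mu
-- rule forces the body of μα.e to be a head normal form, and every head
-- normal form is reducible at every type, since applying it either gets
-- stuck on a constant or β-reduces to another head normal form.
module Submission where

open import Defs
open import Data.Nat using (ℕ; zero; suc)
open import Data.List using (_∷_)
open import Data.List.Relation.Unary.Any using (here; there)
open import Data.List.Membership.Propositional using (_∈_)
open import Data.Product using (Σ; _×_; _,_)
open import Data.Empty using (⊥; ⊥-elim)
open import Function using (_∘_; flip)
open import Induction.WellFounded using (Acc; acc)
open import Relation.Binary.PropositionalEquality as ≡
  using (_≡_; _≗_; refl; sym; trans; cong; cong₂)

data Ty : Set where
  o   : Ty
  _⟶_ : Ty → Ty → Ty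

erase : Formula → Ty
erase (atom _ _) = o
erase (∀' F)     = erase F
erase (F ⇒ G)    = erase F ⟶ erase G

erase-openF : ∀ k u F → erase (openF k u F) ≡ erase F
erase-openF k u (atom P ts) = refl
erase-openF k u (∀' F)      = erase-openF (suc k) u F
erase-openF k u (F ⇒ G)     = cong₂ _⟶_ (erase-openF k u F) (erase-openF k u G)

erase-closeF : ∀ k x F → erase (closeF k x F) ≡ erase F
erase-closeF k x (atom P ts) = refl
erase-closeF k x (∀' F)      = erase-closeF (suc k) x F
erase-closeF k x (F ⇒ G)     = cong₂ _⟶_ (erase-closeF k x F) (erase-closeF k x G)

ext-cong : ∀ {ρ ρ'} → ρ ≗ ρ' → ext ρ ≗ ext ρ'
ext-cong h zero    = refl
ext-cong h (suc n) = cong suc (h n)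

ext-∘ : ∀ ρ ρ' → ext ρ ∘ ext ρ' ≗ ext (ρ ∘ ρ')
ext-∘ ρ ρ' zero    = refl
ext-∘ ρ ρ' (suc n) = refl

rename-cong : ∀ {ρ ρ'} → ρ ≗ ρ' → rename ρ ≗ rename ρ'
rename-cong h (κ c)    = refl
rename-cong h (var n)  = cong var (h n)
rename-cong h (ƛ e)    = cong ƛ (rename-cong (ext-cong h) e)
rename-cong h (e ∙ e') = cong₂ _∙_ (rename-cong h e) (rename-cong h e')
rename-cong h (μ e)    = cong μ (rename-cong (ext-cong h) e)

rename-rename : ∀ ρ ρ' → rename ρ ∘ rename ρ' ≗ rename (ρ ∘ ρ')
rename-rename ρ ρ' (κ c)    = refl
rename-rename ρ ρ' (var n)  = refl
rename-rename ρ ρ' (ƛ e)    =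
  cong ƛ (trans (rename-rename (ext ρ) (ext ρ') e) (rename-cong (ext-∘ ρ ρ') e))
rename-rename ρ ρ' (e ∙ e') = cong₂ _∙_ (rename-rename ρ ρ' e) (rename-rename ρ ρ' e')
rename-rename ρ ρ' (μ e)    =
  cong μ (trans (rename-rename (ext ρ) (ext ρ') e) (rename-cong (ext-∘ ρ ρ') e))

exts-cong : ∀ {σ τ} → σ ≗ τ → exts σ ≗ exts τ
exts-cong h zero    = refl
exts-cong h (suc n) = cong (rename suc) (h n)

exts-ext : ∀ τ ρ → exts τ ∘ ext ρ ≗ exts (τ ∘ ρ)
exts-ext τ ρ zero    = refl
exts-ext τ ρ (suc n) = refl

exts-var : exts var ≗ var
exts-var zero    = refl
exts-var (suc n) = refl

subst-cong : ∀ {σ τ} → σ ≗ τ → subst σ ≗ subst τ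
subst-cong h (κ c)    = refl
subst-cong h (var n)  = h n
subst-cong h (ƛ e)    = cong ƛ (subst-cong (exts-cong h) e)
subst-cong h (e ∙ e') = cong₂ _∙_ (subst-cong h e) (subst-cong h e')
subst-cong h (μ e)    = cong μ (subst-cong (exts-cong h) e)

subst-rename : ∀ τ ρ → subst τ ∘ rename ρ ≗ subst (τ ∘ ρ)
subst-rename τ ρ (κ c)    = refl
subst-rename τ ρ (var n)  = refl
subst-rename τ ρ (ƛ e)    =
  cong ƛ (trans (subst-rename (exts τ) (ext ρ) e) (subst-cong (exts-ext τ ρ) e))
subst-rename τ ρ (e ∙ e') = cong₂ _∙_ (subst-rename τ ρ e) (subst-rename τ ρ e')
subst-rename τ ρ (μ e)    =
  cong μ (trans (subst-rename (exts τ) (ext ρ) e) (subst-cong (exts-ext τ ρ) e))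

rename-exts : ∀ ρ σ → rename (ext ρ) ∘ exts σ ≗ exts (rename ρ ∘ σ)
rename-exts ρ σ zero    = refl
rename-exts ρ σ (suc n) =
  trans (rename-rename (ext ρ) suc (σ n)) (sym (rename-rename suc ρ (σ n)))

rename-subst : ∀ ρ σ → rename ρ ∘ subst σ ≗ subst (rename ρ ∘ σ)
rename-subst ρ σ (κ c)    = refl
rename-subst ρ σ (var n)  = refl
rename-subst ρ σ (ƛ e)    =
  cong ƛ (trans (rename-subst (ext ρ) (exts σ) e) (subst-cong (rename-exts ρ σ) e))
rename-subst ρ σ (e ∙ e') = cong₂ _∙_ (rename-subst ρ σ e) (rename-subst ρ σ e')
rename-subst ρ σ (μ e)    =
  cong μ (trans (rename-subst (ext ρ) (exts σ) e) (subst-cong (rename-exts ρ σ) e))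

subst-exts : ∀ τ σ → subst (exts τ) ∘ exts σ ≗ exts (subst τ ∘ σ)
subst-exts τ σ zero    = refl
subst-exts τ σ (suc n) =
  trans (subst-rename (exts τ) suc (σ n)) (sym (rename-subst suc τ (σ n)))

subst-subst : ∀ τ σ → subst τ ∘ subst σ ≗ subst (subst τ ∘ σ)
subst-subst τ σ (κ c)    = refl
subst-subst τ σ (var n)  = refl
subst-subst τ σ (ƛ e)    =
  cong ƛ (trans (subst-subst (exts τ) (exts σ) e) (subst-cong (subst-exts τ σ) e))
subst-subst τ σ (e ∙ e') = cong₂ _∙_ (subst-subst τ σ e) (subst-subst τ σ e')
subst-subst τ σ (μ e)    =
  cong μ (trans (subst-subst (exts τ) (exts σ) e) (subst-cong (subst-exts τ σ) e))

subst-var : subst var ≗ (λ e → e)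
subst-var (κ c)    = refl
subst-var (var n)  = refl
subst-var (ƛ e)    = cong ƛ (trans (subst-cong exts-var e) (subst-var e))
subst-var (e ∙ e') = cong₂ _∙_ (subst-var e) (subst-var e')
subst-var (μ e)    = cong μ (trans (subst-cong exts-var e) (subst-var e))

infixr 5 _∷ₛ_
_∷ₛ_ : Ev → (ℕ → Ev) → ℕ → Ev
(a ∷ₛ σ) zero    = a
(a ∷ₛ σ) (suc n) = σ n

subst-exts-[] : ∀ σ a e → subst (exts σ) e [ a ] ≡ subst (a ∷ₛ σ) e
subst-exts-[] σ a e = trans (subst-subst (sub0 a) (exts σ) e) (subst-cong sub0-exts e)
  where
  sub0-exts : subst (sub0 a) ∘ exts σ ≗ a ∷ₛ σ
  sub0-exts zero    = refl
  sub0-exts (suc n) = trans (subst-rename (sub0 a) suc (σ n)) (subst-var (σ n))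

Spine-subst : ∀ σ {e} → Spine e → Spine (subst σ e)
Spine-subst σ (sp-κ c)   = sp-κ c
Spine-subst σ (sp-app s) = sp-app (Spine-subst σ s)

HNF-subst : ∀ σ {e} → HNF e → HNF (subst σ e)
HNF-subst σ (hnf-spine s) = hnf-spine (Spine-subst σ s)
HNF-subst σ (hnf-lam h)   = hnf-lam (HNF-subst (exts σ) h)

↝-deterministic : ∀ {e e₁ e₂} → e ↝ e₁ → e ↝ e₂ → e₁ ≡ e₂
↝-deterministic β-μ     β-μ     = refl
↝-deterministic β-λ     β-λ     = refl
↝-deterministic β-λ     (ctx ())
↝-deterministic (ctx ()) β-λ
↝-deterministic (ctx s) (ctx t) = cong (_∙ _) (↝-deterministic s t)

data Neutral : Ev → Set where
  var : ∀ n → Neutral (var n)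
  κ   : ∀ c → Neutral (κ c)
  _∙_ : ∀ {e} → Neutral e → ∀ a → Neutral (e ∙ a)

Neutral-irreducible : ∀ {e e'} → Neutral e → e ↝ e' → ⊥
Neutral-irreducible (() ∙ _) β-λ
Neutral-irreducible (n ∙ _)  (ctx s) = Neutral-irreducible n s

Spine⇒Neutral : ∀ {e} → Spine e → Neutral e
Spine⇒Neutral (sp-κ c)   = κ c
Spine⇒Neutral (sp-app s) = Spine⇒Neutral s ∙ _

SN : Ev → Set
SN = Acc (flip _↝_)

SN⇒Terminating : ∀ {e} → SN e → Terminating e
SN⇒Terminating (acc rs) (f , refl , steps) =
  SN⇒Terminating (rs (steps 0)) (f ∘ suc , refl , steps ∘ suc)

SN-∙ˡ : ∀ {e a} → SN (e ∙ a) → SN e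
SN-∙ˡ (acc rs) = acc (λ s → SN-∙ˡ (rs (ctx s)))

Reducible : Ty → Ev → Set
Reducible o       e = SN e
Reducible (A ⟶ B) e = ∀ a → Reducible A a → Reducible B (e ∙ a)

Reducible-expand : ∀ A {e e'} → e ↝ e' → Reducible A e' → Reducible A e
Reducible-expand o       s r = acc (λ t → ≡.subst SN (↝-deterministic s t) r)
Reducible-expand (A ⟶ B) s r = λ a ra → Reducible-expand B (ctx s) (r a ra)

Neutral-reducible : ∀ A {e} → Neutral e → Reducible A e
Neutral-reducible o       n = acc (λ s → ⊥-elim (Neutral-irreducible n s))
Neutral-reducible (A ⟶ B) n = λ a _ → Neutral-reducible B (n ∙ a)

HNF-reducible : ∀ A {e} → HNF e → Reducible A e
HNF-reducible A       (hnf-spine s) = Neutral-reducible A (Spine⇒Neutral s)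
HNF-reducible o       (hnf-lam h)   = acc (λ ())
HNF-reducible (A ⟶ B) (hnf-lam h)   =
  λ a _ → Reducible-expand B β-λ (HNF-reducible B (HNF-subst (sub0 a) h))

Reducible⇒SN : ∀ A {e} → Reducible A e → SN e
Reducible⇒SN o       r = r
Reducible⇒SN (A ⟶ B) r = SN-∙ˡ (Reducible⇒SN B (r (var 0) (Neutral-reducible A (var 0))))

infix 4 _⊨_
_⊨_ : (ℕ → Ev) → Ctx → Set
σ ⊨ Φ = ∀ {n G} → (var n , G) ∈ Φ → Reducible (erase G) (σ n)

∈-shiftCtx : ∀ Φ {n G} → (var n , G) ∈ shiftCtx Φ →
             Σ ℕ λ m → n ≡ suc m × (var m , G) ∈ Φ
∈-shiftCtx ((var m , _) ∷ Φ) (here refl) = m , refl , here refl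
∈-shiftCtx ((κ _   , _) ∷ Φ) (here ())
∈-shiftCtx ((ƛ _   , _) ∷ Φ) (here ())
∈-shiftCtx ((_ ∙ _ , _) ∷ Φ) (here ())
∈-shiftCtx ((μ _   , _) ∷ Φ) (here ())
∈-shiftCtx (_ ∷ Φ)           (there p) with ∈-shiftCtx Φ p
... | m , eq , q = m , eq , there q

⊨-∷ₛ : ∀ {σ Φ a F} → σ ⊨ Φ → Reducible (erase F) a → a ∷ₛ σ ⊨ Φ ,α∶ F
⊨-∷ₛ         g r {zero}  (here refl) = r
⊨-∷ₛ         g r {suc n} (here ())
⊨-∷ₛ {Φ = Φ} g r         (there p) with ∈-shiftCtx Φ p
... | m , refl , q = g q

var⊨ : ∀ Φ → var ⊨ Φ
var⊨ Φ {n} {G} _ = Neutral-reducible (erase G) (var n)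

fundamental : ∀ {Φ e F σ} → Φ ⊢ e ∶ F → σ ⊨ Φ → Reducible (erase F) (subst σ e)
fundamental (Assump (atom-κ c) _)   g = Neutral-reducible _ (κ c)
fundamental (Assump (atom-var _) p) g = g p
fundamental (App d₁ d₂)             g = fundamental d₂ g _ (fundamental d₁ g)
fundamental {e = ƛ e} {σ = σ} (Abs {F = F} d) g = λ a ra →
  Reducible-expand (erase F) β-λ
    (≡.subst (Reducible (erase F)) (sym (subst-exts-[] σ a e)) (fundamental d (⊨-∷ₛ g ra)))
fundamental {e = e} {σ = σ} (Gen {F = F} {x = x} d _) g =
  ≡.subst (λ A → Reducible A (subst σ e)) (sym (erase-closeF 0 x F)) (fundamental d g)
fundamental {e = e} {σ = σ} (Inst {F = F} {t = t} _ d) g =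
  ≡.subst (λ A → Reducible A (subst σ e)) (sym (erase-openF 0 t F)) (fundamental d g)
fundamental {σ = σ} (Mu {F = F} _ h) g =
  Reducible-expand (erase F) β-μ (HNF-reducible (erase F) (HNF-subst _ (HNF-subst (exts σ) h)))

theorem5 : ∀ (Φ : Ctx) (e : Ev) (F : Formula) → Φ ⊢ e ∶ F → Terminating e
theorem5 Φ e F d =
  SN⇒Terminating (≡.subst SN (subst-var e) (Reducible⇒SN (erase F) (fundamental d (var⊨ Φ))))
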